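{- Let $1\le i\le m$, $\alpha\in T$, and $x\in V(\Gamma)\setminus V(\Gamma_i(\alpha))$. Then $x$ has at most one neighbour (in the underlying graph $\Sigma$) in $V(\Gamma_i(\alpha))$.
   Context: Standing setting: $S$ is a set of $q\ge2$ elements, $d\ge1$, $\Gamma$ is a commutative weakly distance-regular digraph with vertex set $S^d$ (arcs are ordered pairs of distinct vertices; $\Gamma$ strongly connected and, writing $\tilde\partial_\Gamma(x,y)=(\partial_\Gamma(x,y),\partial_\Gamma(y,x))$ for two-way directed distance, the number of $z$ with $\tilde\partial_\Gamma(x,z)=\tilde i$, $\tilde\partial_\Gamma(z,y)=\tilde j$ depends only on $\tilde i,\tilde j,\tilde\partial_\Gamma(x,y)$ and is symmetric in $\tilde i,\tilde j$). Its underlying graph $\Sigma$ ($x\sim y$ iff $(x,y)$ or $(y,x)$ is an arc) is distance-regular with $a_1=q-2$ (adjacent vertices have $q-2$ common neighbours) and $c_2=2$ (vertices at distance 2 have 2 common neighbours). Fix $o\in S$, $o_{[k]}=(o,\dots,o)$ ($k$ entries). For $1\le j\le d$, $\Gamma^{[j]}$ is the digraph on $S^j$ with $(\beta,\gamma)$ an arc iff $((\beta,o_{[d-j]}),(\gamma,o_{[d-j]}))$ is an arc of $\Gamma$; assume that for some $1\le m\le d$ the underlying graph of $\Gamma^{[m]}$ is the Hamming graph on $S^m$ (adjacent iff differing in exactly one coordinate). $T=S^{m-1}\times\{o_{[d-m]}\}\subseteq S^{d-1}$. For $1\le i\le d$ and $\alpha=(a_1,\dots,a_{d-1})\in S^{d-1}$,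 $\Gamma_i(\alpha)$ is the induced subdigraph of $\Gamma$ on $\{(a_1,\dots,a_{i-1},b,a_i,\dots,a_{d-1}):b\in S\}$. -}

module Defs where

open import Data.Nat using (ℕ; zero; suc; _+_; _∸_; _<_; _≤_)
open import Data.Fin using (Fin; _↑ˡ_)
open import Data.Vec using (Vec; lookup; _++_; replicate; insertAt)
open import Data.List using (List; length)
open import Data.List.Membership.Propositional using (_∈_)
open import Data.List.Relation.Unary.Unique.Propositional using (Unique)
open import Data.Product using (Σ; ∃; _×_)
open import Data.Sum using (_⊎_)
open import Relation.Nullary using (¬_)
open import Relation.Binary.PropositionalEquality using (_≡_; _≢_)

Count : {A : Set} → (A → Set) → ℕ → Set
Count {A} P n = Σ (List A) λ l →
  Unique l × (∀ z → (z ∈ l → P z) × (P z → z ∈ l)) × length l ≡ n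

data Walk {A : Set} (R : A → A → Set) : ℕ → A → A → Set where
  here : ∀ {x} → Walk R 0 x x
  step : ∀ {n x y z} → R x y → Walk R n y z → Walk R (suc n) x z

Dist : {A : Set} → (A → A → Set) → A → A → ℕ → Set
Dist R x y n = Walk R n x y × (∀ k → k < n → ¬ Walk R k x y)

Irreflexive : {A : Set} → (A → A → Set) → Set
Irreflexive R = ∀ {x y} → R x y → x ≢ y

StronglyConnected : {A : Set} → (A → A → Set) → Set
StronglyConnected R = ∀ x y → ∃ λ n → Walk R n x y

Und : {A : Set} → (A → A → Set) → A → A → Set
Und R x y = R x y ⊎ R y x

-- commutative weakly distance-regular digraph; two-way distances ~i = (i1,i2)
IsCommWDRD : {A : Set} → (A → A → Set) → Set
IsCommWDRD {A} R =
  Irreflexive R × StronglyConnected R ×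
  Σ (ℕ → ℕ → ℕ → ℕ → ℕ → ℕ → ℕ) λ p →
    (∀ x y h1 h2 i1 i2 j1 j2 → Dist R x y h1 → Dist R y x h2 →
       Count (λ z → (Dist R x z i1 × Dist R z x i2) × (Dist R z y j1 × Dist R y z j2))
             (p i1 i2 j1 j2 h1 h2)) ×
    (∀ i1 i2 j1 j2 h1 h2 → p i1 i2 j1 j2 h1 h2 ≡ p j1 j2 i1 i2 h1 h2)

IsDRG : {A : Set} → (A → A → Set) → Set
IsDRG {A} R =
  (∀ x y → ∃ λ n → Walk R n x y) ×
  Σ (ℕ → ℕ → ℕ → ℕ) λ p →
    ∀ x y h i j → Dist R x y h →
      Count (λ z → Dist R x z i × Dist R z y j) (p i j h)

HasA1 : {A : Set} → (A → A → Set) → ℕ → Set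
HasA1 R a = ∀ x y → R x y → Count (λ z → R x z × R z y) a

HasC2 : {A : Set} → (A → A → Set) → ℕ → Set
HasC2 R c = ∀ x y → Dist R x y 2 → Count (λ z → R x z × R z y) c

HammingAdj : {S : Set} {m : ℕ} → Vec S m → Vec S m → Set
HammingAdj {S} {m} β γ = Count (λ (k : Fin m) → lookup β k ≢ lookup γ k) 1

SubArc : {S : Set} {m r : ℕ} → (Vec S (m + r) → Vec S (m + r) → Set) → S →
         Vec S m → Vec S m → Set
SubArc {r = r} Arc o β γ = Arc (β ++ replicate r o) (γ ++ replicate r o)

-- vertex set of Γ_i(α), for α = (β, o_[r]) ∈ T and position k+1 (k : Fin (suc m'))
InFibre : {S : Set} {m' r : ℕ} → S → Fin (suc m') → Vec S m' → Vec S (suc m' + r) → Set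
InFibre {S} {m'} {r} o k β x = Σ S λ b → x ≡ insertAt (β ++ replicate r o) (k ↑ˡ r) b

{-# OPTIONS --safe #-}
module Submission where

-- The fibre Γ_i(α) is a q-clique of Σ, since its underlying Hamming graph on S^m
-- joins any two of its points. If x outside the fibre had two distinct neighbours
-- y, z in it, then x together with the q - 2 remaining fibre vertices would be
-- q - 1 common neighbours of the adjacent vertices y and z, contradicting a₁ = q - 2.

open import Defs
open import Data.Nat using (ℕ; suc; _+_; _∸_; _≤_; s≤s)
open import Data.Nat.Properties using (1+n≰n)
open import Data.Fin using (Fin; _↑ˡ_; zero; suc; punchIn; punchOut; _≟_)
open import Data.Fin.Properties using (injective⇒≤; punchIn-punchOut)
open import Data.Vec using (Vec; _∷_; lookup; _++_; replicate; insertAt)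
open import Data.Vec.Properties using (insertAt-lookup; insertAt-punchIn)
open import Data.List using (List; length; [_]; _∷_)
import Data.List as List
open import Data.List.Membership.Propositional using (_∈_)
open import Data.List.Relation.Unary.Any using (here; there; index)
open import Data.List.Relation.Unary.Any.Properties using (lookup-index)
open import Data.List.Relation.Unary.All using (_∷_; [])
open import Data.List.Relation.Unary.AllPairs using (_∷_; [])
open import Data.Product using (_×_; _,_; proj₁; proj₂)
open import Data.Sum using (inj₁; inj₂)
open import Data.Empty using (⊥-elim)
open import Function.Definitions using (Injective)
open import Relation.Nullary using (¬_; yes; no)
open import Relation.Binary.PropositionalEquality hiding ([_])

Und-sym : ∀ {A : Set} {R : A → A → Set} {x y} → Und R x y → Und R y x
Und-sym (inj₁ p) = inj₂ p
Und-sym (inj₂ p) = inj₁ p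

injective⇒≤-length : ∀ {A : Set} {n} (h : Fin n → A) → Injective _≡_ _≡_ h →
  (l : List A) → (∀ c → h c ∈ l) → n ≤ length l
injective⇒≤-length h h-injective l h∈l = injective⇒≤ {f = λ c → index (h∈l c)} λ {a} {b} e →
  h-injective (begin
    h a                           ≡⟨ lookup-index (h∈l a) ⟩
    List.lookup l (index (h∈l a)) ≡⟨ cong (List.lookup l) e ⟩
    List.lookup l (index (h∈l b)) ≡⟨ lookup-index (h∈l b) ⟨
    h b                           ∎)
  where open ≡-Reasoning

insertAt-++ : ∀ {A : Set} {n r} (xs : Vec A n) (ys : Vec A r) (k : Fin (suc n)) (v : A) →
  insertAt (xs ++ ys) (k ↑ˡ r) v ≡ insertAt xs k v ++ ys
insertAt-++ xs       ys zero    v = refl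
insertAt-++ (x ∷ xs) ys (suc k)  v = cong (x ∷_) (insertAt-++ xs ys k v)

insertAt-injective : ∀ {A : Set} {n} (xs : Vec A n) (k : Fin (suc n)) →
  Injective _≡_ _≡_ (insertAt xs k)
insertAt-injective xs k {c} {d} e =
  trans (sym (insertAt-lookup xs k c)) (trans (cong (λ v → lookup v k) e) (insertAt-lookup xs k d))

insertAt-lookup-≢ : ∀ {A : Set} {n} (xs : Vec A n) {k j : Fin (suc n)} → k ≢ j → (c d : A) →
  lookup (insertAt xs k c) j ≡ lookup (insertAt xs k d) j
insertAt-lookup-≢ xs {k} {j} k≢j c d = begin
  lookup (insertAt xs k c) j                          ≡⟨ cong (lookup (insertAt xs k c)) (punchIn-punchOut k≢j) ⟨
  lookup (insertAt xs k c) (punchIn k (punchOut k≢j)) ≡⟨ insertAt-punchIn xs k c _ ⟩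
  lookup xs (punchOut k≢j)                            ≡⟨ insertAt-punchIn xs k d _ ⟨
  lookup (insertAt xs k d) (punchIn k (punchOut k≢j)) ≡⟨ cong (lookup (insertAt xs k d)) (punchIn-punchOut k≢j) ⟩
  lookup (insertAt xs k d) j                          ∎
  where open ≡-Reasoning

insertAt-hammingAdj : ∀ {A : Set} {n} (xs : Vec A n) (k : Fin (suc n)) {c d : A} → c ≢ d →
  HammingAdj (insertAt xs k c) (insertAt xs k d)
insertAt-hammingAdj xs k {c} {d} c≢d = [ k ] , ([] ∷ []) , (λ j → ∈⇒differ j , differ⇒∈ j) , refl
  where
  ∈⇒differ : ∀ j → j ∈ [ k ] → lookup (insertAt xs k c) j ≢ lookup (insertAt xs k d) j
  ∈⇒differ j (here refl) e =
    c≢d (trans (sym (insertAt-lookup xs k c)) (trans e (insertAt-lookup xs k d)))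
  differ⇒∈ : ∀ j → lookup (insertAt xs k c) j ≢ lookup (insertAt xs k d) j → j ∈ [ k ]
  differ⇒∈ j differ with j ≟ k
  ... | yes refl = here refl
  ... | no j≢k   = ⊥-elim (differ (insertAt-lookup-≢ xs (λ e → j≢k (sym e)) c d))

module _ {A : Set} {R : A → A → Set} {q a : ℕ} (a₁ : HasA1 R a)
         (f : Fin q → A) (f-injective : Injective _≡_ _≡_ f)
         (f-clique : ∀ {c d} → c ≢ d → R (f c) (f d)) where

  clique-outsider-two-neighbours⇒≤ : ∀ {x b b'} → (∀ c → f c ≢ x) → b ≢ b' →
    R (f b) x → R x (f b') → q ≤ suc a
  clique-outsider-two-neighbours⇒≤ {x} {b} {b'} x∉f b≢b' fb-x x-fb' =
    subst (λ n → q ≤ suc n) (proj₂ (proj₂ (proj₂ common))) (injective⇒≤-length h h-injective _ h∈)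
    where
    common : Count (λ w → R (f b) w × R w (f b')) a
    common = a₁ (f b) (f b') (f-clique b≢b')
    common-neighbour⇒∈ : ∀ w → R (f b) w × R w (f b') → w ∈ proj₁ common
    common-neighbour⇒∈ w = proj₂ (proj₁ (proj₂ (proj₂ common)) w)
    -- f with its value at b replaced by x; every value is f b' or a common neighbour.
    h : Fin q → A
    h c with c ≟ b
    ... | yes _ = x
    ... | no _  = f c
    h-injective : Injective _≡_ _≡_ h
    h-injective {c} {d} e with c ≟ b | d ≟ b
    ... | yes c≡b | yes d≡b = trans c≡b (sym d≡b)
    ... | yes _   | no _    = ⊥-elim (x∉f d (sym e))
    ... | no _    | yes _   = ⊥-elim (x∉f c e)
    ... | no _    | no _    = f-injective e
    h∈ : ∀ c → h c ∈ f b' ∷ proj₁ common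
    h∈ c with c ≟ b
    ... | yes _ = there (common-neighbour⇒∈ x (fb-x , x-fb'))
    ... | no c≢b with c ≟ b'
    ...   | yes refl = here refl
    ...   | no c≢b' = there (common-neighbour⇒∈ (f c) (f-clique (λ e → c≢b (sym e)) , f-clique c≢b'))

fibre : ∀ {S : Set} {m' r} → S → Fin (suc m') → Vec S m' → S → Vec S (suc m' + r)
fibre {r = r} o k β c = insertAt (β ++ replicate r o) (k ↑ˡ r) c

fibre-injective : ∀ {S : Set} {m' r} (o : S) (k : Fin (suc m')) (β : Vec S m') →
  Injective _≡_ _≡_ (fibre {r = r} o k β)
fibre-injective {r = r} o k β = insertAt-injective (β ++ replicate r o) (k ↑ˡ r)

fibre-clique : ∀ {S : Set} {m' r} (Arc : Vec S (suc m' + r) → Vec S (suc m' + r) → Set) (o : S) →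
  (∀ β γ → HammingAdj β γ → Und (SubArc {m = suc m'} {r = r} Arc o) β γ) →
  (k : Fin (suc m')) (β : Vec S m') → ∀ {c d} → c ≢ d → Und Arc (fibre o k β c) (fibre o k β d)
fibre-clique {r = r} Arc o hamming⇒adj k β {c} {d} c≢d =
  subst₂ (Und Arc) (sym (insertAt-++ β (replicate r o) k c)) (sym (insertAt-++ β (replicate r o) k d))
    (hamming⇒adj (insertAt β k c) (insertAt β k d) (insertAt-hammingAdj β k c≢d))

lemma3p6 : (q : ℕ) → 2 ≤ q → (m' r : ℕ) →
           (Arc : Vec (Fin q) (suc m' + r) → Vec (Fin q) (suc m' + r) → Set) →
           (o : Fin q) →
           IsCommWDRD Arc →
           IsDRG (Und Arc) →
           HasA1 (Und Arc) (q ∸ 2) →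
           HasC2 (Und Arc) 2 →
           (∀ β γ → (Und (SubArc {m = suc m'} {r = r} Arc o) β γ → HammingAdj β γ) × (HammingAdj β γ → Und (SubArc {m = suc m'} {r = r} Arc o) β γ)) →
           (k : Fin (suc m')) → (β : Vec (Fin q) m') → (x : Vec (Fin q) (suc m' + r)) →
           ¬ InFibre o k β x →
           ∀ y z → InFibre o k β y → InFibre o k β z →
           Und Arc x y → Und Arc x z → y ≡ z
lemma3p6 (suc (suc q')) (s≤s (s≤s _)) m' r Arc o _ _ a₁ _ hamming k β x x∉fibre _ _ (b , refl) (b' , refl) x-y x-z
  with b ≟ b'
... | yes refl = refl
... | no b≢b'  = ⊥-elim (1+n≰n (clique-outsider-two-neighbours⇒≤ a₁
        (fibre o k β) (fibre-injective o k β) (fibre-clique Arc o (λ β γ → proj₂ (hamming β γ)) k β)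
        (λ c e → x∉fibre (c , sym e)) b≢b' (Und-sym {R = Arc} x-y) x-z))
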